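{- Let $T=(F_0,F_1,F_2)$ be a template of order $10$ and type $(4,4,2,2,2)$, so that rows $0$–$3$ and columns $0$–$3$ are relational and each $F_m$ has exactly two ones in every row and column. Let $Q_1$ be the set of cells in rows $0$–$3$ and columns $0$–$3$, $Q_2$ the cells in rows $0$–$3$ and columns $4$–$9$, $Q_3$ the cells in rows $4$–$9$ and columns $0$–$3$, and $Q_4$ the cells in rows $4$–$9$ and columns $4$–$9$. Then: (i) every point in $Q_2$ or $Q_3$ has type of the form ${*}{*}000$ (i.e. $F_0,F_1,F_2$ are all $0$ there); (ii) every point in $Q_1$ has type $11001$, $11010$, $11100$ or $11111$, and each of these four types occurs exactly once in each row and exactly once in each column of $Q_1$; (iii) every point in $Q_4$ has type $00001$, $00010$ or $00100$, and each of these three types occurs exactly twice in each row and exactly twice in each column of $Q_4$.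
   Context: A binary frequency square of order $n$ with frequencies $(n-\lambda,\lambda)$ is an $n\times n$ array over $\{0,1\}$ with exactly $\lambda$ ones in each row and each column. Two such squares with frequencies $(n-\lambda,\lambda)$ and $(n-\mu,\mu)$ are orthogonal if the number of cells with entry pair $(a,b)$ is $\lambda_a\mu_b$, where $\lambda_1=\lambda,\lambda_0=n-\lambda,\mu_1=\mu,\mu_0=n-\mu$. For even $n$, a template of order $n$ and type $(\lambda_0,\dots,\lambda_{k-1})$ (all $\lambda_i$ even) is a list $(F_0,\dots,F_{k-3})$ of pairwise orthogonal binary frequency squares of order $n$, $F_{t-2}$ having frequencies $(n-\lambda_t,\lambda_t)$; rows $0,\dots,\lambda_0-1$ and columns $0,\dots,\lambda_1-1$ are called relational. The type of a point (cell) $(i,j)$ is the binary string $x\,y\,F_0[i,j]\cdots F_{k-3}[i,j]$, where $x=1$ iff row $i$ is relational and $y=1$ iff column $j$ is relational; its weight is the number of ones in the type. It is required that every point has weight congruent mod $2$ to $\chi=\frac12\sum_i\lambda_i$ (for type $(4,4,2,2,2)$, $\chi=7$, so all weights are odd). A symbol ${*}$ in a type denotes an arbitrary bit. -}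

module Defs where

open import Data.Nat using (ℕ; zero; suc; _+_; _*_; _∸_; _<_; _<ᵇ_; _/_; _%_)
open import Data.Bool using (Bool; true; false; if_then_else_; _∧_; not)
open import Data.Bool.Properties using () renaming (_≟_ to _≟ᵇ_)
open import Data.Fin as Fin using (Fin; toℕ)
open import Data.Vec using (Vec; _∷_; []; tabulate)
open import Data.Vec.Properties using (≡-dec)
open import Relation.Nullary.Decidable using (⌊_⌋)
open import Relation.Binary.PropositionalEquality using (_≡_; _≢_)

-- a binary (0/1-valued) array of order n; true = 1, false = 0
Square : ℕ → Set
Square n = Fin n → Fin n → Bool

sumFin : ∀ {n} → (Fin n → ℕ) → ℕ
sumFin {zero}  f = 0
sumFin {suc n} f = f Fin.zero + sumFin {n} (λ i → f (Fin.suc i))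

count : ∀ {n} → (Fin n → Bool) → ℕ
count P = sumFin (λ i → if P i then 1 else 0)

countCells : ∀ {n} → (Fin n → Fin n → Bool) → ℕ
countCells P = sumFin (λ i → count (P i))

IsBFS : (n lam : ℕ) → Square n → Set
IsBFS n lam F = (∀ i → count (λ j → F i j) ≡ lam) × (∀ j → count (λ i → F i j) ≡ lam)
  where open import Data.Product using (_×_)

freq : ℕ → ℕ → Bool → ℕ
freq n lam true  = lam
freq n lam false = n ∸ lam

_==ᵇ_ : Bool → Bool → Bool
a ==ᵇ b = ⌊ a ≟ᵇ b ⌋

Orthogonal : (n lam mu : ℕ) → Square n → Square n → Set
Orthogonal n lam mu F G =
  ∀ (a b : Bool) → countCells (λ i j → (F i j ==ᵇ a) ∧ (G i j ==ᵇ b)) ≡ freq n lam a * freq n mu b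

Even : ℕ → Set
Even m = m % 2 ≡ 0

rel : ∀ {n} → ℕ → Fin n → Bool
rel bound i = toℕ i <ᵇ bound

-- type of the point (i , j): x y F_0[i,j] ... F_{k-1}[i,j]
-- (here the k squares F_0..F_{k-1} correspond to the paper's F_0..F_{k'-3})
pointType : ∀ {n k} (λ₀ λ₁ : ℕ) → (Fin k → Square n) → Fin n → Fin n → Vec Bool (2 + k)
pointType λ₀ λ₁ F i j = rel λ₀ i ∷ rel λ₁ j ∷ tabulate (λ m → F m i j)

weight : ∀ {m} → Vec Bool m → ℕ
weight []      = 0
weight (b ∷ v) = (if b then 1 else 0) + weight v

-- A template of order n and type (λ₀ , λ₁ , λs 0 , … , λs (k-1)) with squares F 0 … F (k-1)
-- (F m is the paper's F_m, with frequencies (n - λ_{m+2} , λ_{m+2})).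
record IsTemplate (n λ₀ λ₁ : ℕ) {k : ℕ} (λs : Fin k → ℕ) (F : Fin k → Square n) : Set where
  field
    n-even   : Even n
    λ₀-even  : Even λ₀
    λ₁-even  : Even λ₁
    λs-even  : ∀ m → Even (λs m)
    bfs      : ∀ m → IsBFS n (λs m) (F m)
    orth     : ∀ m m' → m ≢ m' → Orthogonal n (λs m) (λs m') (F m) (F m')
    parity   : ∀ i j → weight (pointType λ₀ λ₁ F i j) % 2 ≡ ((λ₀ + λ₁ + sumFin λs) / 2) % 2

_==ᵛ_ : ∀ {m} → Vec Bool m → Vec Bool m → Bool
u ==ᵛ v = ⌊ ≡-dec _≟ᵇ_ u v ⌋

O I : Bool
O = false
I = true

λs42 : Fin 3 → ℕ
λs42 _ = 2

small : Fin 10 → Bool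
small i = toℕ i <ᵇ 4

large : Fin 10 → Bool
large i = not (small i)

{-# OPTIONS --safe #-}
module Submission where

-- The load of a point, i.e. the number of squares with a one there, has the parity of 7 minus
-- its two relational bits. On a non-relational line the six non-relational points therefore need
-- a positive load, while the three squares put only six ones on the line: those points have load
-- exactly one and the four relational points load zero. This settles Q₂, Q₃ and Q₄. In Q₁ the load
-- is odd, and along a relational line all six ones lie in Q₁; writing w for the number of 11111
-- points and p, q, r for the other three types, w + p = w + q = w + r = 2 and w + p + q + r = 4,
-- so each is 1. Columns follow from rows by transposing the template.

open import Defs
open import Data.Nat using (ℕ; zero; suc; _+_; _/_; _%_; _≤_; z≤n; s≤s)
open import Data.Nat.Properties
  using (≤-antisym; ≤-trans; ≤-reflexive; +-mono-≤; +-monoˡ-≤; +-monoʳ-≤; +-cancelˡ-≤; +-cancelʳ-≤;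
         +-comm; +-commutativeSemigroup)
open import Algebra.Properties.CommutativeSemigroup +-commutativeSemigroup
  using (interchange) renaming (x∙yz≈y∙xz to +-left-comm)
open import Data.Bool using (Bool; true; false; _∧_; not; if_then_else_)
open import Data.Bool.Properties using (∧-commutativeMonoid; not-injective) renaming (_≟_ to _≟ᵇ_)
open import Algebra.Bundles using (CommutativeMonoid)
open import Algebra.Properties.CommutativeSemigroup (CommutativeMonoid.commutativeSemigroup ∧-commutativeMonoid)
  using () renaming (x∙yz≈y∙xz to ∧-left-comm)
open import Data.Fin using (Fin; zero; suc)
open import Data.Vec using (Vec; _∷_; []; tabulate; replicate)
open import Data.Vec.Properties using (≡-dec)
open import Relation.Nullary.Decidable using (isYes≗does)
open import Data.Product using (_×_; _,_; proj₁; proj₂; swap)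
open import Data.Sum using (_⊎_; inj₁; inj₂)
open import Function using (_∘_)
open import Relation.Binary.PropositionalEquality
  using (_≡_; refl; sym; trans; cong; cong₂; subst; module ≡-Reasoning)

open ≡-Reasoning

bit : Bool → ℕ
bit b = if b then 1 else 0

sumFin-cong : ∀ {n} {f g : Fin n → ℕ} → (∀ k → f k ≡ g k) → sumFin f ≡ sumFin g
sumFin-cong {zero}  f≗g = refl
sumFin-cong {suc n} f≗g = cong₂ _+_ (f≗g zero) (sumFin-cong (f≗g ∘ suc))

count-cong : ∀ {n} {P Q : Fin n → Bool} → (∀ k → P k ≡ Q k) → count P ≡ count Q
count-cong P≗Q = sumFin-cong (cong bit ∘ P≗Q)

sumFin-+ : ∀ {n} (f g : Fin n → ℕ) → sumFin (λ k → f k + g k) ≡ sumFin f + sumFin g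
sumFin-+ {zero}  f g = refl
sumFin-+ {suc n} f g = begin
  f zero + g zero + sumFin (λ k → f (suc k) + g (suc k))
    ≡⟨ cong (f zero + g zero +_) (sumFin-+ (f ∘ suc) (g ∘ suc)) ⟩
  f zero + g zero + (sumFin (f ∘ suc) + sumFin (g ∘ suc))
    ≡⟨ interchange (f zero) (g zero) _ _ ⟩
  sumFin f + sumFin g ∎

sumFin-split : ∀ {n} {f : Fin n → ℕ} (g h : Fin n → ℕ) →
  (∀ k → f k ≡ g k + h k) → sumFin f ≡ sumFin g + sumFin h
sumFin-split g h f≗g+h = trans (sumFin-cong f≗g+h) (sumFin-+ g h)

sumFin-zero : ∀ n → sumFin {n} (λ _ → 0) ≡ 0
sumFin-zero zero    = refl
sumFin-zero (suc n) = sumFin-zero n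

sumFin-comm : ∀ {m n} (f : Fin m → Fin n → ℕ) →
  sumFin (λ i → sumFin (f i)) ≡ sumFin (λ j → sumFin (λ i → f i j))
sumFin-comm {zero}  {n} f = sym (sumFin-zero n)
sumFin-comm {suc m}     f = begin
  sumFin (f zero) + sumFin (λ i → sumFin (f (suc i)))
    ≡⟨ cong (sumFin (f zero) +_) (sumFin-comm (f ∘ suc)) ⟩
  sumFin (f zero) + sumFin (λ j → sumFin (λ i → f (suc i) j))
    ≡⟨ sym (sumFin-+ (f zero) _) ⟩
  sumFin (λ j → sumFin (λ i → f i j)) ∎

sumFin-mono-≤ : ∀ {n} {f g : Fin n → ℕ} → (∀ k → f k ≤ g k) → sumFin f ≤ sumFin g
sumFin-mono-≤ {zero}  f≤g = z≤n
sumFin-mono-≤ {suc n} f≤g = +-mono-≤ (f≤g zero) (sumFin-mono-≤ (f≤g ∘ suc))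

sumFin-squeeze : ∀ {n} {f g : Fin n → ℕ} →
  (∀ k → g k ≤ f k) → sumFin f ≤ sumFin g → ∀ k → f k ≡ g k
sumFin-squeeze {suc n} {f} {g} g≤f Σf≤Σg zero =
  ≤-antisym (+-cancelʳ-≤ (sumFin (f ∘ suc)) (f zero) (g zero)
              (≤-trans Σf≤Σg (+-monoʳ-≤ (g zero) (sumFin-mono-≤ (g≤f ∘ suc)))))
            (g≤f zero)
sumFin-squeeze {suc n} {f} {g} g≤f Σf≤Σg (suc k) =
  sumFin-squeeze (g≤f ∘ suc) (+-cancelˡ-≤ (f zero) _ _ (≤-trans Σf≤Σg (+-monoˡ-≤ _ (g≤f zero)))) k

weight-tabulate : ∀ {k} (f : Fin k → Bool) → weight (tabulate f) ≡ count f
weight-tabulate {zero}  f = refl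
weight-tabulate {suc k} f = cong (bit (f zero) +_) (weight-tabulate (f ∘ suc))

weight≡0⇒replicate : ∀ {m} (v : Vec Bool m) → weight v ≡ 0 → v ≡ replicate m false
weight≡0⇒replicate []          _ = refl
weight≡0⇒replicate (false ∷ v) w≡0 = cong (false ∷_) (weight≡0⇒replicate v w≡0)
weight≡0⇒replicate (true ∷ v)  ()

swap-relational : ∀ {k} → Vec Bool (2 + k) → Vec Bool (2 + k)
swap-relational (x ∷ y ∷ v) = y ∷ x ∷ v

weight-swap-relational : ∀ {k} (v : Vec Bool (2 + k)) → weight (swap-relational v) ≡ weight v
weight-swap-relational (x ∷ y ∷ v) = +-left-comm (bit y) (bit x) (weight v)

==ᵛ-∷ : ∀ {m} x y (u v : Vec Bool m) → ((x ∷ u) ==ᵛ (y ∷ v)) ≡ (x ==ᵇ y) ∧ (u ==ᵛ v)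
==ᵛ-∷ x y u v = trans (isYes≗does (≡-dec _≟ᵇ_ (x ∷ u) (y ∷ v)))
                      (sym (cong₂ _∧_ (isYes≗does (x ≟ᵇ y)) (isYes≗does (≡-dec _≟ᵇ_ u v))))

==ᵛ-swap-relational : ∀ {k} (u t : Vec Bool (2 + k)) →
  (swap-relational u ==ᵛ swap-relational t) ≡ (u ==ᵛ t)
==ᵛ-swap-relational (x ∷ y ∷ u) (z ∷ w ∷ t) = begin
  (y ∷ x ∷ u) ==ᵛ (w ∷ z ∷ t)            ≡⟨ ==ᵛ-∷ y w _ _ ⟩
  (y ==ᵇ w) ∧ ((x ∷ u) ==ᵛ (z ∷ t))      ≡⟨ cong ((y ==ᵇ w) ∧_) (==ᵛ-∷ x z u t) ⟩
  (y ==ᵇ w) ∧ ((x ==ᵇ z) ∧ (u ==ᵛ t))    ≡⟨ ∧-left-comm (y ==ᵇ w) (x ==ᵇ z) (u ==ᵛ t) ⟩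
  (x ==ᵇ z) ∧ ((y ==ᵇ w) ∧ (u ==ᵛ t))    ≡⟨ cong ((x ==ᵇ z) ∧_) (==ᵛ-∷ y w u t) ⟨
  (x ==ᵇ z) ∧ ((y ∷ u) ==ᵛ (w ∷ t))      ≡⟨ ==ᵛ-∷ x z _ _ ⟨
  (x ∷ y ∷ u) ==ᵛ (z ∷ w ∷ t) ∎

load : ∀ {n k} → (Fin k → Square n) → Fin n → Fin n → ℕ
load F i j = weight (tabulate (λ m → F m i j))

row-load : ∀ {n k} {λs : Fin k → ℕ} {F : Fin k → Square n} →
  (∀ m → IsBFS n (λs m) (F m)) → ∀ i → sumFin (load F i) ≡ sumFin λs
row-load {λs = λs} {F} bfs i = begin
  sumFin (load F i)                               ≡⟨ sumFin-cong (λ j → weight-tabulate (λ m → F m i j)) ⟩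
  sumFin (λ j → sumFin (λ m → bit (F m i j)))     ≡⟨ sumFin-comm (λ j m → bit (F m i j)) ⟩
  sumFin (λ m → count (F m i))                    ≡⟨ sumFin-cong (λ m → proj₁ (bfs m) i) ⟩
  sumFin λs ∎

column-load : ∀ {n k} {λs : Fin k → ℕ} {F : Fin k → Square n} →
  (∀ m → IsBFS n (λs m) (F m)) → ∀ j → sumFin (λ i → load F i j) ≡ sumFin λs
column-load {λs = λs} {F} bfs j = begin
  sumFin (λ i → load F i j)                       ≡⟨ sumFin-cong (λ i → weight-tabulate (λ m → F m i j)) ⟩
  sumFin (λ i → sumFin (λ m → bit (F m i j)))     ≡⟨ sumFin-comm (λ i m → bit (F m i j)) ⟩
  sumFin (λ m → count (λ i → F m i j))            ≡⟨ sumFin-cong (λ m → proj₂ (bfs m) j) ⟩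
  sumFin λs ∎

bit+s-odd⇒bit-not≤s : ∀ b s → (bit b + s) % 2 ≡ 1 → bit (not b) ≤ s
bit+s-odd⇒bit-not≤s true  s       _  = z≤n
bit+s-odd⇒bit-not≤s false (suc s) _  = s≤s z≤n
bit+s-odd⇒bit-not≤s false zero    ()

parity-squeeze : ∀ {n} (x : Fin n → Bool) (s : Fin n → ℕ) →
  (∀ k → (bit (x k) + s k) % 2 ≡ 1) → sumFin s ≤ count (not ∘ x) → ∀ k → s k ≡ bit (not (x k))
parity-squeeze x s odd = sumFin-squeeze (λ k → bit+s-odd⇒bit-not≤s (x k) (s k) (odd k))

transpose : ∀ {n k} → (Fin k → Square n) → Fin k → Square n
transpose F m i j = F m j i

transpose-template : ∀ {n λ₀ λ₁ k} {λs : Fin k → ℕ} {F : Fin k → Square n} →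
  IsTemplate n λ₀ λ₁ λs F → IsTemplate n λ₁ λ₀ λs (transpose F)
transpose-template {n} {λ₀} {λ₁} {λs = λs} {F} T = record
  { n-even  = n-even
  ; λ₀-even = λ₁-even
  ; λ₁-even = λ₀-even
  ; λs-even = λs-even
  ; bfs     = swap ∘ bfs
  ; orth    = λ m m' m≢m' a b →
      trans (sumFin-comm (λ i j → bit ((F m j i ==ᵇ a) ∧ (F m' j i ==ᵇ b)))) (orth m m' m≢m' a b)
  ; parity  = parityᵀ
  }
  where
    open IsTemplate T
    parityᵀ : ∀ i j →
      weight (pointType λ₁ λ₀ (transpose F) i j) % 2 ≡ ((λ₁ + λ₀ + sumFin λs) / 2) % 2
    parityᵀ i j = begin
      weight (swap-relational (pointType λ₀ λ₁ F j i)) % 2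
        ≡⟨ cong (_% 2) (weight-swap-relational (pointType λ₀ λ₁ F j i)) ⟩
      weight (pointType λ₀ λ₁ F j i) % 2
        ≡⟨ parity j i ⟩
      ((λ₀ + λ₁ + sumFin λs) / 2) % 2
        ≡⟨ cong (λ l → ((l + sumFin λs) / 2) % 2) (+-comm λ₀ λ₁) ⟩
      ((λ₁ + λ₀ + sumFin λs) / 2) % 2 ∎

data OddPattern : Vec Bool 3 → Set where
  ⟨001⟩ : OddPattern (O ∷ O ∷ I ∷ [])
  ⟨010⟩ : OddPattern (O ∷ I ∷ O ∷ [])
  ⟨100⟩ : OddPattern (I ∷ O ∷ O ∷ [])
  ⟨111⟩ : OddPattern (I ∷ I ∷ I ∷ [])

data UnitPattern : Vec Bool 3 → Set where
  ⟨001⟩ : UnitPattern (O ∷ O ∷ I ∷ [])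
  ⟨010⟩ : UnitPattern (O ∷ I ∷ O ∷ [])
  ⟨100⟩ : UnitPattern (I ∷ O ∷ O ∷ [])

data Admissible : Vec Bool 5 → Set where
  Q₁ : ∀ {v} → OddPattern v → Admissible (I ∷ I ∷ v)
  Q₂ : Admissible (I ∷ O ∷ O ∷ O ∷ O ∷ [])
  Q₃ : Admissible (O ∷ I ∷ O ∷ O ∷ O ∷ [])
  Q₄ : ∀ {v} → UnitPattern v → Admissible (O ∷ O ∷ v)

odd-pattern : ∀ {a b c} → weight (a ∷ b ∷ c ∷ []) % 2 ≡ 1 → OddPattern (a ∷ b ∷ c ∷ [])
odd-pattern {false} {false} {false} ()
odd-pattern {false} {false} {true}  _  = ⟨001⟩
odd-pattern {false} {true}  {false} _  = ⟨010⟩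
odd-pattern {false} {true}  {true}  ()
odd-pattern {true}  {false} {false} _  = ⟨100⟩
odd-pattern {true}  {false} {true}  ()
odd-pattern {true}  {true}  {false} ()
odd-pattern {true}  {true}  {true}  _  = ⟨111⟩

unit-pattern : ∀ {a b c} → weight (a ∷ b ∷ c ∷ []) ≡ 1 → UnitPattern (a ∷ b ∷ c ∷ [])
unit-pattern {false} {false} {false} ()
unit-pattern {false} {false} {true}  _  = ⟨001⟩
unit-pattern {false} {true}  {false} _  = ⟨010⟩
unit-pattern {false} {true}  {true}  ()
unit-pattern {true}  {false} {false} _  = ⟨100⟩
unit-pattern {true}  {false} {true}  ()
unit-pattern {true}  {true}  {false} ()
unit-pattern {true}  {true}  {true}  ()

classify : ∀ {x y a b c} → let v = a ∷ b ∷ c ∷ [] in (bit x + (bit y + weight v)) % 2 ≡ 1 →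
  (y ≡ false → weight v ≡ bit (not x)) → (x ≡ false → weight v ≡ bit (not y)) → Admissible (x ∷ y ∷ v)
classify {true}  {true}  odd _            _         = Q₁ (odd-pattern odd)
classify {true}  {false} _   large-column _         =
  subst (λ u → Admissible (I ∷ O ∷ u)) (sym (weight≡0⇒replicate _ (large-column refl))) Q₂
classify {false} {true}  _   _            large-row =
  subst (λ u → Admissible (O ∷ I ∷ u)) (sym (weight≡0⇒replicate _ (large-row refl))) Q₃
classify {false} {false} _   large-column _         = Q₄ (unit-pattern (large-column refl))

Q₁Type Q₄Type : Vec Bool 5 → Set
Q₁Type t = t ≡ I ∷ I ∷ O ∷ O ∷ I ∷ [] ⊎ t ≡ I ∷ I ∷ O ∷ I ∷ O ∷ []
         ⊎ t ≡ I ∷ I ∷ I ∷ O ∷ O ∷ [] ⊎ t ≡ I ∷ I ∷ I ∷ I ∷ I ∷ []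
Q₄Type t = t ≡ O ∷ O ∷ O ∷ O ∷ I ∷ [] ⊎ t ≡ O ∷ O ∷ O ∷ I ∷ O ∷ [] ⊎ t ≡ O ∷ O ∷ I ∷ O ∷ O ∷ []

odd-pattern⇒Q₁Type : ∀ {v} → OddPattern v → Q₁Type (I ∷ I ∷ v)
odd-pattern⇒Q₁Type ⟨001⟩ = inj₁ refl
odd-pattern⇒Q₁Type ⟨010⟩ = inj₂ (inj₁ refl)
odd-pattern⇒Q₁Type ⟨100⟩ = inj₂ (inj₂ (inj₁ refl))
odd-pattern⇒Q₁Type ⟨111⟩ = inj₂ (inj₂ (inj₂ refl))

unit-pattern⇒Q₄Type : ∀ {v} → UnitPattern v → Q₄Type (O ∷ O ∷ v)
unit-pattern⇒Q₄Type ⟨001⟩ = inj₁ refl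
unit-pattern⇒Q₄Type ⟨010⟩ = inj₂ (inj₁ refl)
unit-pattern⇒Q₄Type ⟨100⟩ = inj₂ (inj₂ refl)

Q₁Type-swap : ∀ {t} → Q₁Type t → Q₁Type (swap-relational t)
Q₁Type-swap (inj₁ refl)                = inj₁ refl
Q₁Type-swap (inj₂ (inj₁ refl))         = inj₂ (inj₁ refl)
Q₁Type-swap (inj₂ (inj₂ (inj₁ refl)))  = inj₂ (inj₂ (inj₁ refl))
Q₁Type-swap (inj₂ (inj₂ (inj₂ refl)))  = inj₂ (inj₂ (inj₂ refl))

Q₄Type-swap : ∀ {t} → Q₄Type t → Q₄Type (swap-relational t)
Q₄Type-swap (inj₁ refl)         = inj₁ refl
Q₄Type-swap (inj₂ (inj₁ refl))  = inj₂ (inj₁ refl)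
Q₄Type-swap (inj₂ (inj₂ refl))  = inj₂ (inj₂ refl)

admissible-off-diagonal : ∀ {x y a b c} → Admissible (x ∷ y ∷ a ∷ b ∷ c ∷ []) →
  (x ∧ not y) ≡ true ⊎ (not x ∧ y) ≡ true → a ≡ false × b ≡ false × c ≡ false
admissible-off-diagonal (Q₁ _) (inj₁ ())
admissible-off-diagonal (Q₁ _) (inj₂ ())
admissible-off-diagonal Q₂     _ = refl , refl , refl
admissible-off-diagonal Q₃     _ = refl , refl , refl
admissible-off-diagonal (Q₄ _) (inj₁ ())
admissible-off-diagonal (Q₄ _) (inj₂ ())

admissible-Q₁ : ∀ {x y v} → Admissible (x ∷ y ∷ v) → (x ∧ y) ≡ true → Q₁Type (x ∷ y ∷ v)
admissible-Q₁ (Q₁ p) _ = odd-pattern⇒Q₁Type p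
admissible-Q₁ Q₂     ()
admissible-Q₁ Q₃     ()
admissible-Q₁ (Q₄ _) ()

admissible-Q₄ : ∀ {x y v} → Admissible (x ∷ y ∷ v) → (not x ∧ not y) ≡ true → Q₄Type (x ∷ y ∷ v)
admissible-Q₄ (Q₁ _) ()
admissible-Q₄ Q₂     ()
admissible-Q₄ Q₃     ()
admissible-Q₄ (Q₄ p) _ = unit-pattern⇒Q₄Type p

Q₁-row-decomposition : ∀ {x y a b c} → x ≡ true → Admissible (x ∷ y ∷ a ∷ b ∷ c ∷ []) →
  let hit : Vec Bool 3 → ℕ
      hit p = bit (y ∧ ((x ∷ y ∷ a ∷ b ∷ c ∷ []) ==ᵛ (I ∷ I ∷ p)))
      w = hit (I ∷ I ∷ I ∷ [])
  in bit c ≡ w + hit (O ∷ O ∷ I ∷ []) × bit b ≡ w + hit (O ∷ I ∷ O ∷ [])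
     × bit a ≡ w + hit (I ∷ O ∷ O ∷ [])
     × bit y ≡ w + (hit (O ∷ O ∷ I ∷ []) + (hit (O ∷ I ∷ O ∷ []) + hit (I ∷ O ∷ O ∷ [])))
Q₁-row-decomposition refl (Q₁ ⟨001⟩) = refl , refl , refl , refl
Q₁-row-decomposition refl (Q₁ ⟨010⟩) = refl , refl , refl , refl
Q₁-row-decomposition refl (Q₁ ⟨100⟩) = refl , refl , refl , refl
Q₁-row-decomposition refl (Q₁ ⟨111⟩) = refl , refl , refl , refl
Q₁-row-decomposition refl Q₂         = refl , refl , refl , refl

Q₄-row-hits : ∀ {x y a b c} → x ≡ false → Admissible (x ∷ y ∷ a ∷ b ∷ c ∷ []) →
  let hit : Vec Bool 3 → Bool
      hit p = not y ∧ ((x ∷ y ∷ a ∷ b ∷ c ∷ []) ==ᵛ (O ∷ O ∷ p))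
  in hit (O ∷ O ∷ I ∷ []) ≡ c × hit (O ∷ I ∷ O ∷ []) ≡ b × hit (I ∷ O ∷ O ∷ []) ≡ a
Q₄-row-hits refl Q₃         = refl , refl , refl
Q₄-row-hits refl (Q₄ ⟨001⟩) = refl , refl , refl
Q₄-row-hits refl (Q₄ ⟨010⟩) = refl , refl , refl
Q₄-row-hits refl (Q₄ ⟨100⟩) = refl , refl , refl

unique-solution : ∀ w p q r → w + p ≡ 2 → w + q ≡ 2 → w + r ≡ 2 → w + (p + (q + r)) ≡ 4 →
  w ≡ 1 × p ≡ 1 × q ≡ 1 × r ≡ 1
unique-solution 0 _ _ _ refl refl refl ()
unique-solution 1 _ _ _ refl refl refl refl = refl , refl , refl , refl
unique-solution 2 _ _ _ refl refl refl ()
unique-solution (suc (suc (suc w))) _ _ _ () _ _ _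

row-occurrences column-occurrences :
  (Fin 3 → Square 10) → (Fin 10 → Bool) → Vec Bool 5 → Fin 10 → ℕ
row-occurrences    F S t i = count (λ j → S j ∧ (pointType 4 4 F i j ==ᵛ t))
column-occurrences F S t j = count (λ i → S i ∧ (pointType 4 4 F i j ==ᵛ t))

column-occurrences-transpose : ∀ F S t j →
  column-occurrences F S t j ≡ row-occurrences (transpose F) S (swap-relational t) j
column-occurrences-transpose F S t@(_ ∷ _ ∷ _) j =
  count-cong (λ i → cong (S i ∧_) (sym (==ᵛ-swap-relational (pointType 4 4 F i j) t)))

module Template₄₄₂₂₂ (F : Fin 3 → Square 10) (T : IsTemplate 10 4 4 λs42 F) where
  open IsTemplate T

  load-in-large-column : ∀ j → small j ≡ false → ∀ i → load F i j ≡ bit (large i)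
  load-in-large-column j sj =
    parity-squeeze small (λ i → load F i j) odd (≤-reflexive (column-load {λs = λs42} {F} bfs j))
    where
      odd : ∀ i → (bit (small i) + load F i j) % 2 ≡ 1
      odd i = subst (λ y → (bit (small i) + (bit y + load F i j)) % 2 ≡ 1) sj (parity i j)

  load-in-large-row : ∀ i → small i ≡ false → ∀ j → load F i j ≡ bit (large j)
  load-in-large-row i si =
    parity-squeeze small (load F i) odd (≤-reflexive (row-load {λs = λs42} {F} bfs i))
    where
      odd : ∀ j → (bit (small j) + load F i j) % 2 ≡ 1
      odd j = subst (λ x → (bit x + (bit (small j) + load F i j)) % 2 ≡ 1) si (parity i j)

  admissible : ∀ i j → Admissible (pointType 4 4 F i j)
  admissible i j =
    classify (parity i j) (λ sj → load-in-large-column j sj i) (λ si → load-in-large-row i si j)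

  Q₁-row-solution : ∀ i → small i ≡ true →
    let occ = λ t → row-occurrences F small t i in
    occ (I ∷ I ∷ I ∷ I ∷ I ∷ []) ≡ 1 × occ (I ∷ I ∷ O ∷ O ∷ I ∷ []) ≡ 1
    × occ (I ∷ I ∷ O ∷ I ∷ O ∷ []) ≡ 1 × occ (I ∷ I ∷ I ∷ O ∷ O ∷ []) ≡ 1
  Q₁-row-solution i si =
    unique-solution _ _ _ _
      (via (suc (suc zero)) (proj₁ ∘ cell))
      (via (suc zero) (proj₁ ∘ proj₂ ∘ cell))
      (via zero (proj₁ ∘ proj₂ ∘ proj₂ ∘ cell))
      relational-columns
    where
      cell = λ j → Q₁-row-decomposition si (admissible i j)
      hits : Vec Bool 3 → Fin 10 → ℕ
      hits u j = bit (small j ∧ (pointType 4 4 F i j ==ᵛ (I ∷ I ∷ u)))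
      w p q r : Fin 10 → ℕ
      w = hits (I ∷ I ∷ I ∷ [])
      p = hits (O ∷ O ∷ I ∷ [])
      q = hits (O ∷ I ∷ O ∷ [])
      r = hits (I ∷ O ∷ O ∷ [])

      via : ∀ m {u} → (∀ j → bit (F m i j) ≡ w j + hits u j) → sumFin w + sumFin (hits u) ≡ 2
      via m {u} e = trans (sym (sumFin-split w (hits u) e)) (proj₁ (bfs m) i)

      relational-columns : sumFin w + (sumFin p + (sumFin q + sumFin r)) ≡ 4
      relational-columns = begin
        sumFin w + (sumFin p + (sumFin q + sumFin r))
          ≡⟨ cong (λ z → sumFin w + (sumFin p + z)) (sumFin-+ q r) ⟨
        sumFin w + (sumFin p + sumFin (λ j → q j + r j))
          ≡⟨ cong (sumFin w +_) (sumFin-+ p (λ j → q j + r j)) ⟨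
        sumFin w + sumFin (λ j → p j + (q j + r j))
          ≡⟨ sumFin-split w (λ j → p j + (q j + r j)) (proj₂ ∘ proj₂ ∘ proj₂ ∘ cell) ⟨
        count small                                       ≡⟨⟩
        4 ∎

  Q₁-row-occurrences : ∀ {t} → Q₁Type t → ∀ i → small i ≡ true → row-occurrences F small t i ≡ 1
  Q₁-row-occurrences (inj₁ refl)               i si = proj₁ (proj₂ (Q₁-row-solution i si))
  Q₁-row-occurrences (inj₂ (inj₁ refl))        i si = proj₁ (proj₂ (proj₂ (Q₁-row-solution i si)))
  Q₁-row-occurrences (inj₂ (inj₂ (inj₁ refl))) i si = proj₂ (proj₂ (proj₂ (Q₁-row-solution i si)))
  Q₁-row-occurrences (inj₂ (inj₂ (inj₂ refl))) i si = proj₁ (Q₁-row-solution i si)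

  Q₄-row-occurrences : ∀ {t} → Q₄Type t → ∀ i → large i ≡ true → row-occurrences F large t i ≡ 2
  Q₄-row-occurrences (inj₁ refl) i li =
    trans (count-cong (λ j → proj₁ (Q₄-row-hits (not-injective {y = false} li) (admissible i j))))
          (proj₁ (bfs (suc (suc zero))) i)
  Q₄-row-occurrences (inj₂ (inj₁ refl)) i li =
    trans (count-cong (λ j → proj₁ (proj₂ (Q₄-row-hits (not-injective {y = false} li) (admissible i j)))))
          (proj₁ (bfs (suc zero)) i)
  Q₄-row-occurrences (inj₂ (inj₂ refl)) i li =
    trans (count-cong (λ j → proj₂ (proj₂ (Q₄-row-hits (not-injective {y = false} li) (admissible i j)))))
          (proj₁ (bfs zero) i)

lemma3p4 : (F : Fin 3 → Square 10) → IsTemplate 10 4 4 λs42 F →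
  -- (i) points of Q2 and Q3 have type **000
  (∀ i j → ((small i ∧ large j) ≡ true ⊎ (large i ∧ small j) ≡ true) →
    (F zero i j ≡ false × F (suc zero) i j ≡ false × F (suc (suc zero)) i j ≡ false))
  ×
  -- (ii) points of Q1 have type 11001, 11010, 11100 or 11111 ...
  ((∀ i j → (small i ∧ small j) ≡ true →
      (pointType 4 4 F i j ≡ I ∷ I ∷ O ∷ O ∷ I ∷ []
       ⊎ pointType 4 4 F i j ≡ I ∷ I ∷ O ∷ I ∷ O ∷ []
       ⊎ pointType 4 4 F i j ≡ I ∷ I ∷ I ∷ O ∷ O ∷ []
       ⊎ pointType 4 4 F i j ≡ I ∷ I ∷ I ∷ I ∷ I ∷ []))
   -- ... each occurring exactly once in each row and each column of Q1
   × (∀ (t : Vec Bool 5) →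
        (t ≡ I ∷ I ∷ O ∷ O ∷ I ∷ [] ⊎ t ≡ I ∷ I ∷ O ∷ I ∷ O ∷ []
         ⊎ t ≡ I ∷ I ∷ I ∷ O ∷ O ∷ [] ⊎ t ≡ I ∷ I ∷ I ∷ I ∷ I ∷ []) →
        (∀ i → small i ≡ true → count (λ j → small j ∧ (pointType 4 4 F i j ==ᵛ t)) ≡ 1)
        × (∀ j → small j ≡ true → count (λ i → small i ∧ (pointType 4 4 F i j ==ᵛ t)) ≡ 1)))
  ×
  -- (iii) points of Q4 have type 00001, 00010 or 00100 ...
  ((∀ i j → (large i ∧ large j) ≡ true →
      (pointType 4 4 F i j ≡ O ∷ O ∷ O ∷ O ∷ I ∷ []
       ⊎ pointType 4 4 F i j ≡ O ∷ O ∷ O ∷ I ∷ O ∷ []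
       ⊎ pointType 4 4 F i j ≡ O ∷ O ∷ I ∷ O ∷ O ∷ []))
   -- ... each occurring exactly twice in each row and each column of Q4
   × (∀ (t : Vec Bool 5) →
        (t ≡ O ∷ O ∷ O ∷ O ∷ I ∷ [] ⊎ t ≡ O ∷ O ∷ O ∷ I ∷ O ∷ [] ⊎ t ≡ O ∷ O ∷ I ∷ O ∷ O ∷ []) →
        (∀ i → large i ≡ true → count (λ j → large j ∧ (pointType 4 4 F i j ==ᵛ t)) ≡ 2)
        × (∀ j → large j ≡ true → count (λ i → large i ∧ (pointType 4 4 F i j ==ᵛ t)) ≡ 2)))
lemma3p4 F T =
    (λ i j → admissible-off-diagonal (admissible i j))
  , ( (λ i j → admissible-Q₁ (admissible i j))
    , λ t t∈Q₁ → Q₁-row-occurrences t∈Q₁ , Q₁-column-occurrences t∈Q₁)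
  , ( (λ i j → admissible-Q₄ (admissible i j))
    , λ t t∈Q₄ → Q₄-row-occurrences t∈Q₄ , Q₄-column-occurrences t∈Q₄)
  where
    open Template₄₄₂₂₂ F T
    module Transposed = Template₄₄₂₂₂ (transpose F) (transpose-template T)

    Q₁-column-occurrences : ∀ {t} → Q₁Type t → ∀ j → small j ≡ true → column-occurrences F small t j ≡ 1
    Q₁-column-occurrences {t} t∈Q₁ j sj =
      trans (column-occurrences-transpose F small t j)
            (Transposed.Q₁-row-occurrences (Q₁Type-swap t∈Q₁) j sj)

    Q₄-column-occurrences : ∀ {t} → Q₄Type t → ∀ j → large j ≡ true → column-occurrences F large t j ≡ 2
    Q₄-column-occurrences {t} t∈Q₄ j lj =
      trans (column-occurrences-transpose F large t j)
            (Transposed.Q₄-row-occurrences (Q₄Type-swap t∈Q₄) j lj)
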